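{- Let $0<\gamma\le 1/25$ and let $\ell,n$ be positive integers with $4\le \ell\le n$. Then every tournament on $n$ vertices admits a robust $\mathbf{H}(\ell,\gamma)$-partition.
   Context: Let $T$ be a tournament of order $n$, $0\le\gamma\le 1$, and $\ell>0$. A tuple $(W_1,\dots,W_r,w_1,\dots,w_{r-1})$ ($r$ a positive integer) consisting of pairwise disjoint vertex sets $W_1,\dots,W_r\subseteq V(T)$ and distinct vertices $w_1,\dots,w_{r-1}\in V(T)\setminus\bigcup_i W_i$ is an $\mathbf{H}(\ell,\gamma)$-partition of $T$ if (A1) $\bigcup_{i\in[r]}W_i\cup\{w_1,\dots,w_{r-1}\}=V(T)$; (A2) $\gamma\ell\le |W_i|\le \ell$ for each $i\in[r]$; (A3) for each $i\in[r-1]$, every vertex of $W_i$ sends an arc to $w_i$ and $w_i$ sends an arc to every vertex of $W_{i+1}$. It is robust if additionally (A4) for each $i\in[r-1]$ there exist $i'\le i<j'\le r$ with $|E[W_{i'},W_{j'}]|\ge \gamma|W_{i'}||W_{j'}|-n$, where $E[X,Y]$ is the set of arcs of $T$ from $X$ to $Y$. -}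

module Defs where

open import Data.Nat using (ℕ; zero; suc; _+_; _<_; _≤_)
open import Data.Fin using (Fin; zero; suc; toℕ; inject₁)
open import Data.Fin.Subset using (Subset; _∈_; _∉_; ∣_∣)
open import Data.Vec using (lookup)
open import Data.Bool using (Bool; true; false; _∧_; not; if_then_else_)
open import Data.Integer using (+_)
open import Data.Rational using (ℚ; _/_; _*_; _-_) renaming (_≤_ to _≤ℚ_)
open import Data.Product using (Σ; ∃; _×_)
open import Data.Sum using (_⊎_)
open import Data.Empty using (⊥)
open import Relation.Binary.PropositionalEquality using (_≡_; _≢_)

ℕ→ℚ : ℕ → ℚ
ℕ→ℚ n = (+ n) / 1

∑ : (n : ℕ) → (Fin n → ℕ) → ℕ
∑ zero    f = 0
∑ (suc n) f = f zero + ∑ n (λ i → f (suc i))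

-- A tournament on vertex set Fin n: T u v ≡ true means there is an arc u → v.
-- No loops, and for distinct u, v exactly one of the arcs u → v, v → u.
IsTournament : (n : ℕ) → (Fin n → Fin n → Bool) → Set
IsTournament n T = (∀ u → T u u ≡ false) × (∀ u v → u ≢ v → T u v ≡ not (T v u))

arcs : {n : ℕ} → (Fin n → Fin n → Bool) → Subset n → Subset n → ℕ
arcs {n} T X Y = ∑ n (λ x → ∑ n (λ y →
  if lookup X x ∧ lookup Y y ∧ T x y then 1 else 0))

Disjoint : {n : ℕ} → Subset n → Subset n → Set
Disjoint {n} A B = ∀ (x : Fin n) → x ∈ A → x ∈ B → ⊥

-- H(ℓ,γ)-partition with r = suc k parts W : Fin (suc k) → Subset n and
-- connecting vertices w : Fin k → Fin n; W_i = W (inject₁ i), W_{i+1} = W (suc i).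
IsHPartition : (n : ℕ) → (Fin n → Fin n → Bool) → ℕ → ℚ →
               (k : ℕ) → (Fin (suc k) → Subset n) → (Fin k → Fin n) → Set
IsHPartition n T ℓ γ k W w =
  (∀ i j → i ≢ j → Disjoint (W i) (W j)) ×
  (∀ i j → w i ≡ w j → i ≡ j) ×
  (∀ i j → w i ∉ W j) ×
  (∀ v → (∃ λ i → v ∈ W i) ⊎ (∃ λ j → w j ≡ v)) ×
  -- (A2) sizes
  (∀ i → (γ * ℕ→ℚ ℓ ≤ℚ ℕ→ℚ ∣ W i ∣) × (∣ W i ∣ ≤ ℓ)) ×
  (∀ i → (∀ v → v ∈ W (inject₁ i) → T v (w i) ≡ true) ×
         (∀ v → v ∈ W (suc i) → T (w i) v ≡ true))

-- (A4)
IsRobust : (n : ℕ) → (Fin n → Fin n → Bool) → ℚ →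
           (k : ℕ) → (Fin (suc k) → Subset n) → Set
IsRobust n T γ k W =
  ∀ (i : Fin k) → Σ (Fin (suc k)) λ i' → Σ (Fin (suc k)) λ j' →
    (toℕ i' ≤ toℕ i) × (toℕ i < toℕ j') ×
    (γ * ℕ→ℚ ∣ W i' ∣ * ℕ→ℚ ∣ W j' ∣ - ℕ→ℚ n ≤ℚ ℕ→ℚ (arcs T (W i') (W j')))

HasRobustHPartition : (n : ℕ) → (Fin n → Fin n → Bool) → ℕ → ℚ → Set
HasRobustHPartition n T ℓ γ =
  Σ ℕ λ k → Σ (Fin (suc k) → Subset n) λ W → Σ (Fin k → Fin n) λ w →
    IsHPartition n T ℓ γ k W w × IsRobust n T γ k W

-- Call A, B dense if |A||B| ≤ 25(e(A,B) + n), where e(A,B) counts the arcs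
-- from A to B.  For γ ≤ 1/25 a dense pair of parts satisfies (A4), and a part
-- with at least ℓ/25 vertices satisfies (A2).
--
-- A tournament W with more than ℓ vertices has a pivot c: its in- and
-- out-neighbourhoods X, Y have at least ℓ/25 vertices each and
-- 25·e(X,Y) ≥ |X||Y|.  Otherwise, with |W| = s + 1, t transitive triangles and
-- P = Σ d⁻d⁺, counting Σ d⁻² and Σ d⁺² gives 4t + |W|s + 2P = |W|s², AM–GM
-- gives 4P ≤ |W|s², and the absence of a pivot gives 25t ≤ P + 24sE, where E
-- is the total in- (resp. out-)degree of the vertices whose in- (resp. out-)
-- degree is below ℓ/25.  Such vertices span few arcs, so 625E ≤ 16s², and for
-- s ≥ 4 these bounds are contradictory.
--
-- Splitting W at c, recursing on X and Y and joining the two chains with c as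
-- a new connecting vertex gives the partition.  It is robust at c because X is
-- dense to Y: a set dense to (or from) W = X ∪ Y ∪ {c} is dense to (or from)
-- X or Y, so by induction some part of X is dense to Y, and then dense to some
-- part of Y.
module Submission where

open import Defs
open import Algebra.Bundles using (CommutativeMonoid)
open import Data.Bool using (Bool; true; false; _∧_; not; if_then_else_)
import Data.Bool.Properties as Bool
open import Data.Empty using (⊥; ⊥-elim)
open import Data.Fin using (Fin; zero; suc; toℕ; fromℕ<; inject₁; _≟_)
import Data.Fin.Properties as Finₚ
open import Data.Fin.Subset using (Subset) renaming (_∈_ to _∈ˢ_; ∣_∣ to ∣_∣ˢ)
open import Data.Fin.Subset.Properties using (∣p∣≤n)
open import Data.Integer as ℤ using (+_; +≤+)
import Data.Integer.Properties as ℤₚ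
open import Data.List using ([]; _∷_)
open import Data.Nat
  using (ℕ; zero; suc; pred; _+_; _*_; _∸_; _≤_; _<_; _≤?_; _<?_; z≤n; s≤s; NonZero; >-nonZero)
open import Data.Nat.Coprimality using (1-coprimeTo) renaming (sym to coprime-sym)
open import Data.Nat.Induction using (<-wellFounded)
open import Data.Nat.Properties hiding (_≟_)
open import Data.Nat.Tactic.RingSolver using (solve; solve-∀)
open import Data.Rational as ℚ using (ℚ; 0ℚ; _/_; toℚᵘ; NonNegative) renaming (_≤_ to _≤ℚ_; _<_ to _<ℚ_)
import Data.Rational.Properties as ℚₚ
import Data.Rational.Unnormalised as ℚᵘ
import Data.Rational.Unnormalised.Properties as ℚᵘₚ
open import Data.Product using (_×_; _,_; ∃; ∃₂; proj₁; proj₂)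
open import Data.Sum using (_⊎_; inj₁; inj₂)
open import Data.Vec using (tabulate; lookup)
open import Data.Vec.Properties using (lookup∘tabulate; []=⇒lookup; lookup⇒[]=)
open import Induction.WellFounded using (Acc; acc)
open import Relation.Binary using (tri<; tri≈; tri>)
open import Relation.Binary.PropositionalEquality
open import Relation.Nullary using (¬_; Dec; does; yes; no)
open import Relation.Nullary.Decidable using (_×-dec_)
open import Algebra.Properties.CommutativeSemigroup *-commutativeSemigroup using (x∙yz≈y∙xz)
open import Algebra.Properties.CommutativeSemigroup
  (CommutativeMonoid.commutativeSemigroup Bool.∧-commutativeMonoid) using () renaming (xy∙z≈xz∙y to ∧-swapʳ)
open import Algebra.Properties.Semiring.Sum +-*-semiring
  using (sum; sum-syntax; sum-cong-≗; ∑-distrib-+; ∑-comm; *-distribˡ-sum; *-distribʳ-sum; sum-replicate-zero)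

𝟙 : Bool → ℕ
𝟙 b = if b then 1 else 0

sum-mono-≤ : ∀ {m} {f g : Fin m → ℕ} → (∀ i → f i ≤ g i) → sum f ≤ sum g
sum-mono-≤ {zero}  f≤g = z≤n
sum-mono-≤ {suc m} f≤g = +-mono-≤ (f≤g zero) (sum-mono-≤ (λ i → f≤g (suc i)))

does≡true⇒ : ∀ {P : Set} (p? : Dec P) → does p? ≡ true → P
does≡true⇒ (yes p) _ = p

-- Vertex sets are characteristic functions; `tabulate` turns them into the
-- `Subset`s of the statement.
VSet : ℕ → Set
VSet n = Fin n → Bool

module _ {n : ℕ} where

  infix 4 _∈_ _⊆_
  infixr 7 _∩_

  _∈_ : Fin n → VSet n → Set
  v ∈ A = A v ≡ true

  _⊆_ : VSet n → VSet n → Set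
  A ⊆ B = ∀ {v} → v ∈ A → v ∈ B

  _∩_ : VSet n → VSet n → VSet n
  (A ∩ B) v = A v ∧ B v

  ∩-monoˡ-⊆ : ∀ {A B} C → A ⊆ B → A ∩ C ⊆ B ∩ C
  ∩-monoˡ-⊆ {A} {B} C A⊆B {v} v∈A∩C with A v in v∈A
  ... | true rewrite A⊆B v∈A = v∈A∩C

  ⁅_⁆ : Fin n → VSet n
  ⁅ c ⁆ v = does (v ≟ c)

  sumOver : VSet n → (Fin n → ℕ) → ℕ
  sumOver A g = ∑[ v < n ] (𝟙 (A v) * g v)

  infixl 10 sumOver
  syntax sumOver A (λ v → x) = ∑[ v ∈ A ] x

  size : VSet n → ℕ
  size A = ∑[ v ∈ A ] 1

  ∑∈-cong : ∀ A {f g : Fin n → ℕ} → (∀ {v} → v ∈ A → f v ≡ g v) →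
            ∑[ v ∈ A ] f v ≡ ∑[ v ∈ A ] g v
  ∑∈-cong A {f} {g} f≡g = sum-cong-≗ pointwise
    where
    pointwise : ∀ v → 𝟙 (A v) * f v ≡ 𝟙 (A v) * g v
    pointwise v with A v in v∈A
    ... | true  = cong (_+ 0) (f≡g v∈A)
    ... | false = refl

  ∑∈-mono : ∀ A {f g : Fin n → ℕ} → (∀ {v} → v ∈ A → f v ≤ g v) →
            ∑[ v ∈ A ] f v ≤ ∑[ v ∈ A ] g v
  ∑∈-mono A {f} {g} f≤g = sum-mono-≤ pointwise
    where
    pointwise : ∀ v → 𝟙 (A v) * f v ≤ 𝟙 (A v) * g v
    pointwise v with A v in v∈A
    ... | true  = +-monoˡ-≤ 0 (f≤g v∈A)
    ... | false = z≤n

  ∑∈-mono-⊆ : ∀ A B (g : Fin n → ℕ) → A ⊆ B → ∑[ v ∈ A ] g v ≤ ∑[ v ∈ B ] g v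
  ∑∈-mono-⊆ A B g A⊆B = sum-mono-≤ pointwise
    where
    pointwise : ∀ v → 𝟙 (A v) * g v ≤ 𝟙 (B v) * g v
    pointwise v with A v in v∈A
    ... | true  rewrite A⊆B v∈A = ≤-refl
    ... | false = z≤n

  ∑∈-+ : ∀ A (f g : Fin n → ℕ) → ∑[ v ∈ A ] (f v + g v) ≡ ∑[ v ∈ A ] f v + ∑[ v ∈ A ] g v
  ∑∈-+ A f g = trans (sum-cong-≗ (λ v → *-distribˡ-+ (𝟙 (A v)) (f v) (g v)))
                     (∑-distrib-+ (λ v → 𝟙 (A v) * f v) (λ v → 𝟙 (A v) * g v))

  ∑∈-*ˡ : ∀ A k (f : Fin n → ℕ) → k * ∑[ v ∈ A ] f v ≡ ∑[ v ∈ A ] (k * f v)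
  ∑∈-*ˡ A k f = trans (*-distribˡ-sum k (λ v → 𝟙 (A v) * f v))
                      (sum-cong-≗ (λ v → x∙yz≈y∙xz k (𝟙 (A v)) (f v)))

  ∑∈-const : ∀ A k → ∑[ v ∈ A ] k ≡ size A * k
  ∑∈-const A k = sym (trans (*-distribʳ-sum k (λ v → 𝟙 (A v) * 1))
                            (sum-cong-≗ (λ v → cong (_* k) (*-identityʳ (𝟙 (A v))))))

  ∑∈-comm : ∀ A B (h : Fin n → Fin n → ℕ) →
            ∑[ x ∈ A ] ∑[ y ∈ B ] h x y ≡ ∑[ y ∈ B ] ∑[ x ∈ A ] h x y
  ∑∈-comm A B h = begin
    ∑[ x ∈ A ] ∑[ y ∈ B ] h x y
      ≡⟨ sum-cong-≗ (λ x → *-distribˡ-sum (𝟙 (A x)) (hB x)) ⟩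
    ∑[ x < n ] ∑[ y < n ] (𝟙 (A x) * (𝟙 (B y) * h x y))
      ≡⟨ ∑-comm (λ x y → 𝟙 (A x) * hB x y) ⟩
    ∑[ y < n ] ∑[ x < n ] (𝟙 (A x) * (𝟙 (B y) * h x y))
      ≡⟨ sum-cong-≗ (λ y → sum-cong-≗ (λ x → x∙yz≈y∙xz (𝟙 (A x)) (𝟙 (B y)) (h x y))) ⟩
    ∑[ y < n ] ∑[ x < n ] (𝟙 (B y) * (𝟙 (A x) * h x y))
      ≡⟨ sum-cong-≗ (λ y → *-distribˡ-sum (𝟙 (B y)) (λ x → hA x y)) ⟨
    ∑[ y ∈ B ] ∑[ x ∈ A ] h x y                         ∎
    where
    open ≡-Reasoning
    hA hB : Fin n → Fin n → ℕ
    hA x y = 𝟙 (A x) * h x y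
    hB x y = 𝟙 (B y) * h x y

  ∑∈-∩ : ∀ A B (g : Fin n → ℕ) → ∑[ v ∈ A ∩ B ] g v ≡ ∑[ v ∈ A ] (𝟙 (B v) * g v)
  ∑∈-∩ A B g = sum-cong-≗ pointwise
    where
    pointwise : ∀ v → 𝟙 (A v ∧ B v) * g v ≡ 𝟙 (A v) * (𝟙 (B v) * g v)
    pointwise v with A v
    ... | true  = sym (+-identityʳ _)
    ... | false = refl

  ∑∈-partition : ∀ W A B C (g : Fin n → ℕ) → (∀ v → 𝟙 (W v) ≡ 𝟙 (A v) + 𝟙 (B v) + 𝟙 (C v)) →
                 ∑[ v ∈ W ] g v ≡ ∑[ v ∈ A ] g v + ∑[ v ∈ B ] g v + ∑[ v ∈ C ] g v
  ∑∈-partition W A B C g W≡A+B+C = begin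
    ∑[ v ∈ W ] g v                                   ≡⟨ sum-cong-≗ split ⟩
    ∑[ v < n ] (gA v + gB v + gC v)                  ≡⟨ ∑-distrib-+ (λ v → gA v + gB v) gC ⟩
    ∑[ v < n ] (gA v + gB v) + ∑[ v ∈ C ] g v        ≡⟨ cong (_+ ∑[ v ∈ C ] g v) (∑-distrib-+ gA gB) ⟩
    ∑[ v ∈ A ] g v + ∑[ v ∈ B ] g v + ∑[ v ∈ C ] g v ∎
    where
    open ≡-Reasoning
    gA gB gC : Fin n → ℕ
    gA v = 𝟙 (A v) * g v
    gB v = 𝟙 (B v) * g v
    gC v = 𝟙 (C v) * g v
    split : ∀ v → 𝟙 (W v) * g v ≡ gA v + gB v + gC v
    split v = begin
      𝟙 (W v) * g v                       ≡⟨ cong (_* g v) (W≡A+B+C v) ⟩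
      (𝟙 (A v) + 𝟙 (B v) + 𝟙 (C v)) * g v ≡⟨ *-distribʳ-+ (g v) (𝟙 (A v) + 𝟙 (B v)) (𝟙 (C v)) ⟩
      (𝟙 (A v) + 𝟙 (B v)) * g v + gC v    ≡⟨ cong (_+ gC v) (*-distribʳ-+ (g v) (𝟙 (A v)) (𝟙 (B v))) ⟩
      gA v + gB v + gC v                  ∎

∑∈⁅⁆ : ∀ {n} (c : Fin n) (g : Fin n → ℕ) → ∑[ v ∈ ⁅ c ⁆ ] g v ≡ g c
∑∈⁅⁆ {suc n} zero    g =
  trans (cong₂ _+_ (+-identityʳ (g zero)) (sum-replicate-zero n)) (+-identityʳ (g zero))
∑∈⁅⁆ {suc n} (suc c) g = ∑∈⁅⁆ c (λ v → g (suc v))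

∣tabulate∣≡size : ∀ {n} (A : VSet n) → ∣ tabulate A ∣ˢ ≡ size A
∣tabulate∣≡size {zero}  A = refl
∣tabulate∣≡size {suc n} A with A zero
... | true  = cong suc (∣tabulate∣≡size (λ v → A (suc v)))
... | false = ∣tabulate∣≡size (λ v → A (suc v))

size≤n : ∀ {n} (A : VSet n) → size A ≤ n
size≤n A = subst (_≤ _) (∣tabulate∣≡size A) (∣p∣≤n (tabulate A))

∑≡sum : ∀ m (f : Fin m → ℕ) → ∑ m f ≡ sum f
∑≡sum zero    f = refl
∑≡sum (suc m) f = cong (λ s → f zero + s) (∑≡sum m (λ i → f (suc i)))

∈-tabulate⁻ : ∀ {n} {A : VSet n} {x} → x ∈ˢ tabulate A → x ∈ A
∈-tabulate⁻ {A = A} {x} x∈ = trans (sym (lookup∘tabulate A x)) ([]=⇒lookup x∈)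

∈-tabulate⁺ : ∀ {n} {A : VSet n} {x} → x ∈ A → x ∈ˢ tabulate A
∈-tabulate⁺ {A = A} {x} x∈A = lookup⇒[]= x (tabulate A) (trans (lookup∘tabulate A x) x∈A)

module Digraph {n : ℕ} (T : Fin n → Fin n → Bool) where

  N⁻ N⁺ : VSet n → Fin n → VSet n
  N⁻ B y x = B x ∧ T x y
  N⁺ B x y = B y ∧ T x y

  d⁻ d⁺ : VSet n → Fin n → ℕ
  d⁻ B y = size (N⁻ B y)
  d⁺ B x = size (N⁺ B x)

  e : VSet n → VSet n → ℕ
  e A B = ∑[ x ∈ A ] d⁺ B x

  d⁻≤size : ∀ B y → d⁻ B y ≤ size B
  d⁻≤size B y = ∑∈-mono-⊆ (N⁻ B y) B (λ _ → 1) (λ {x} → Bool.∧-conicalˡ (B x) (T x y))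

  d⁺≤size : ∀ B x → d⁺ B x ≤ size B
  d⁺≤size B x = ∑∈-mono-⊆ (N⁺ B x) B (λ _ → 1) (λ {y} → Bool.∧-conicalˡ (B y) (T x y))

  e≡∑d⁻ : ∀ A B → e A B ≡ ∑[ y ∈ B ] d⁻ A y
  e≡∑d⁻ A B = begin
    ∑[ x ∈ A ] d⁺ B x                     ≡⟨ ∑∈-cong A (λ {x} _ → ∑∈-∩ B (T x) (λ _ → 1)) ⟩
    ∑[ x ∈ A ] ∑[ y ∈ B ] (𝟙 (T x y) * 1) ≡⟨ ∑∈-comm A B (λ x y → 𝟙 (T x y) * 1) ⟩
    ∑[ y ∈ B ] ∑[ x ∈ A ] (𝟙 (T x y) * 1) ≡⟨ ∑∈-cong B (λ {y} _ → ∑∈-∩ A (λ x → T x y) (λ _ → 1)) ⟨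
    ∑[ y ∈ B ] d⁻ A y                     ∎
    where open ≡-Reasoning

  e≤size*size : ∀ A B → e A B ≤ size A * size B
  e≤size*size A B = begin
    ∑[ x ∈ A ] d⁺ B x ≤⟨ ∑∈-mono A (λ {x} _ → d⁺≤size B x) ⟩
    ∑[ x ∈ A ] size B ≡⟨ ∑∈-const A (size B) ⟩
    size A * size B   ∎
    where open ≤-Reasoning

  d⁻-mono-⊆ : ∀ {U W} → U ⊆ W → ∀ c → d⁻ U c ≤ d⁻ W c
  d⁻-mono-⊆ {U} {W} U⊆W c =
    ∑∈-mono-⊆ (N⁻ U c) (N⁻ W c) (λ _ → 1) (∩-monoˡ-⊆ {A = U} {B = W} (λ x → T x c) U⊆W)

  d⁺-mono-⊆ : ∀ {U W} → U ⊆ W → ∀ c → d⁺ U c ≤ d⁺ W c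
  d⁺-mono-⊆ {U} {W} U⊆W c =
    ∑∈-mono-⊆ (N⁺ U c) (N⁺ W c) (λ _ → 1) (∩-monoˡ-⊆ {A = U} {B = W} (T c) U⊆W)

  arcs-within≤∑d⁻ : ∀ {U W} → U ⊆ W → e U U ≤ ∑[ c ∈ U ] d⁻ W c
  arcs-within≤∑d⁻ {U} U⊆W = ≤-trans (≤-reflexive (e≡∑d⁻ U U)) (∑∈-mono U (λ {c} _ → d⁻-mono-⊆ U⊆W c))

  arcs-within≤∑d⁺ : ∀ {U W} → U ⊆ W → e U U ≤ ∑[ c ∈ U ] d⁺ W c
  arcs-within≤∑d⁺ {U} U⊆W = ∑∈-mono U (λ {c} _ → d⁺-mono-⊆ U⊆W c)

  arcs≡e : ∀ A B → arcs T (tabulate A) (tabulate B) ≡ e A B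
  arcs≡e A B = begin
    arcs T (tabulate A) (tabulate B)                                ≡⟨ ∑≡sum n _ ⟩
    ∑[ x < n ] ∑ n (λ y → 𝟙 (lookup (tabulate A) x ∧ lookup (tabulate B) y ∧ T x y))
      ≡⟨ sum-cong-≗ (λ x → trans (∑≡sum n _) (sum-cong-≗ (λ y → pointwise x y))) ⟩
    ∑[ x < n ] ∑[ y < n ] (𝟙 (A x) * (𝟙 (B y ∧ T x y) * 1))
      ≡⟨ sum-cong-≗ (λ x → *-distribˡ-sum (𝟙 (A x)) (λ y → 𝟙 (B y ∧ T x y) * 1)) ⟨
    e A B                                                           ∎
    where
    open ≡-Reasoning
    pointwise : ∀ x y → 𝟙 (lookup (tabulate A) x ∧ lookup (tabulate B) y ∧ T x y) ≡
                        𝟙 (A x) * (𝟙 (B y ∧ T x y) * 1)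
    pointwise x y rewrite lookup∘tabulate A x | lookup∘tabulate B y with A x | B y ∧ T x y
    ... | true  | true  = refl
    ... | true  | false = refl
    ... | false | _     = refl

  d⁺N⁺-comm : ∀ W x c → d⁺ (N⁺ W c) x ≡ d⁺ (N⁺ W x) c
  d⁺N⁺-comm W x c = sum-cong-≗ (λ y → cong (λ b → 𝟙 b * 1) (∧-swapʳ (W y) (T c y) (T x y)))

  d⁻N⁻-comm : ∀ W y c → d⁻ (N⁻ W y) c ≡ d⁻ (N⁻ W c) y
  d⁻N⁻-comm W y c = sum-cong-≗ (λ x → cong (λ b → 𝟙 b * 1) (∧-swapʳ (W x) (T x y) (T x c)))

  triangles : VSet n → ℕ
  triangles W = ∑[ c ∈ W ] e (N⁻ W c) (N⁺ W c)

  ∑e[N⁺,N⁺]≡triangles : ∀ W → ∑[ x ∈ W ] e (N⁺ W x) (N⁺ W x) ≡ triangles W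
  ∑e[N⁺,N⁺]≡triangles W = begin
    ∑[ x ∈ W ] ∑[ c ∈ N⁺ W x ] d⁺ (N⁺ W x) c
      ≡⟨ ∑∈-cong W (λ {x} _ → ∑∈-∩ W (T x) (d⁺ (N⁺ W x))) ⟩
    ∑[ x ∈ W ] ∑[ c ∈ W ] (𝟙 (T x c) * d⁺ (N⁺ W x) c)
      ≡⟨ ∑∈-comm W W (λ x c → 𝟙 (T x c) * d⁺ (N⁺ W x) c) ⟩
    ∑[ c ∈ W ] ∑[ x ∈ W ] (𝟙 (T x c) * d⁺ (N⁺ W x) c)
      ≡⟨ ∑∈-cong W (λ {c} _ → ∑∈-cong W (λ {x} _ → cong (𝟙 (T x c) *_) (d⁺N⁺-comm W c x))) ⟩
    ∑[ c ∈ W ] ∑[ x ∈ W ] (𝟙 (T x c) * d⁺ (N⁺ W c) x)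
      ≡⟨ ∑∈-cong W (λ {c} _ → ∑∈-∩ W (λ x → T x c) (d⁺ (N⁺ W c))) ⟨
    ∑[ c ∈ W ] ∑[ x ∈ N⁻ W c ] d⁺ (N⁺ W c) x          ∎
    where open ≡-Reasoning

  ∑e[N⁻,N⁻]≡triangles : ∀ W → ∑[ y ∈ W ] e (N⁻ W y) (N⁻ W y) ≡ triangles W
  ∑e[N⁻,N⁻]≡triangles W = begin
    ∑[ y ∈ W ] e (N⁻ W y) (N⁻ W y)
      ≡⟨ ∑∈-cong W (λ {y} _ → e≡∑d⁻ (N⁻ W y) (N⁻ W y)) ⟩
    ∑[ y ∈ W ] ∑[ c ∈ N⁻ W y ] d⁻ (N⁻ W y) c
      ≡⟨ ∑∈-cong W (λ {y} _ → ∑∈-∩ W (λ c → T c y) (d⁻ (N⁻ W y))) ⟩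
    ∑[ y ∈ W ] ∑[ c ∈ W ] (𝟙 (T c y) * d⁻ (N⁻ W y) c)
      ≡⟨ ∑∈-comm W W (λ y c → 𝟙 (T c y) * d⁻ (N⁻ W y) c) ⟩
    ∑[ c ∈ W ] ∑[ y ∈ W ] (𝟙 (T c y) * d⁻ (N⁻ W y) c)
      ≡⟨ ∑∈-cong W (λ {c} _ → ∑∈-cong W (λ {y} _ → cong (𝟙 (T c y) *_) (d⁻N⁻-comm W y c))) ⟩
    ∑[ c ∈ W ] ∑[ y ∈ W ] (𝟙 (T c y) * d⁻ (N⁻ W c) y)
      ≡⟨ ∑∈-cong W (λ {c} _ → ∑∈-∩ W (T c) (d⁻ (N⁻ W c))) ⟨
    ∑[ c ∈ W ] ∑[ y ∈ N⁺ W c ] d⁻ (N⁻ W c) y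
      ≡⟨ ∑∈-cong W (λ {c} _ → e≡∑d⁻ (N⁻ W c) (N⁺ W c)) ⟨
    triangles W                                        ∎
    where open ≡-Reasoning

  module Tournament (tournament : IsTournament n T) where

    arc-asym : ∀ {u v} → T u v ≡ true → T v u ≡ true → ⊥
    arc-asym {u} {v} uv vu with u ≟ v
    ... | yes refl = Bool.not-¬ uv (proj₁ tournament u)
    ... | no u≢v   = Bool.not-¬ vu (trans (proj₂ tournament v u (λ v≡u → u≢v (sym v≡u))) (cong not uv))

    arc-trichotomy : ∀ u v → u ≡ v ⊎ T u v ≡ true ⊎ T v u ≡ true
    arc-trichotomy u v with u ≟ v
    ... | yes u≡v = inj₁ u≡v
    ... | no u≢v with T v u in vu
    ...   | true  = inj₂ (inj₂ refl)
    ...   | false = inj₂ (inj₁ (trans (proj₂ tournament u v u≢v) (cong not vu)))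

    vertex-partition : ∀ {W c} → c ∈ W → ∀ x → 𝟙 (W x) ≡ 𝟙 (N⁻ W c x) + 𝟙 (N⁺ W c x) + 𝟙 (⁅ c ⁆ x)
    vertex-partition {W} {c} c∈W x with x ≟ c
    ... | yes refl rewrite c∈W | proj₁ tournament x = refl
    ... | no x≢c rewrite proj₂ tournament x c x≢c with W x | T c x
    ...   | true  | true  = refl
    ...   | true  | false = refl
    ...   | false | _     = refl

    ∑∈-split-at : ∀ {W c} → c ∈ W → ∀ g →
                  ∑[ x ∈ W ] g x ≡ ∑[ x ∈ N⁻ W c ] g x + ∑[ x ∈ N⁺ W c ] g x + g c
    ∑∈-split-at {W} {c} c∈W g =
      trans (∑∈-partition W (N⁻ W c) (N⁺ W c) ⁅ c ⁆ g (vertex-partition {W} {c} c∈W))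
            (cong (λ z → ∑[ x ∈ N⁻ W c ] g x + ∑[ x ∈ N⁺ W c ] g x + z) (∑∈⁅⁆ c g))

    size≡d⁻+d⁺+1 : ∀ {W c} → c ∈ W → size W ≡ d⁻ W c + d⁺ W c + 1
    size≡d⁻+d⁺+1 {W} {c} c∈W = ∑∈-split-at {W} {c} c∈W (λ _ → 1)

    2e+size≡size² : ∀ S → 2 * e S S + size S ≡ size S * size S
    2e+size≡size² S = begin
      2 * e S S + size S
        ≡⟨ cong (_+ size S) (cong₂ _+_ (e≡∑d⁻ S S) (+-identityʳ (e S S))) ⟩
      ∑[ x ∈ S ] d⁻ S x + ∑[ x ∈ S ] d⁺ S x + size S
        ≡⟨ cong (_+ size S) (∑∈-+ S (d⁻ S) (d⁺ S)) ⟨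
      ∑[ x ∈ S ] (d⁻ S x + d⁺ S x) + size S
        ≡⟨ ∑∈-+ S (λ x → d⁻ S x + d⁺ S x) (λ _ → 1) ⟨
      ∑[ x ∈ S ] (d⁻ S x + d⁺ S x + 1)
        ≡⟨ ∑∈-cong S (λ {x} x∈S → sym (size≡d⁻+d⁺+1 {S} {x} x∈S)) ⟩
      ∑[ x ∈ S ] size S
        ≡⟨ ∑∈-const S (size S) ⟩
      size S * size S ∎
      where open ≡-Reasoning

    eˡ-split : ∀ {S c} → c ∈ S → ∀ Q → e S Q ≡ e (N⁻ S c) Q + e (N⁺ S c) Q + d⁺ Q c
    eˡ-split {S} {c} c∈S Q = ∑∈-split-at {S} {c} c∈S (d⁺ Q)

    eʳ-split : ∀ {S c} → c ∈ S → ∀ Q → e Q S ≡ e Q (N⁻ S c) + e Q (N⁺ S c) + d⁻ Q c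
    eʳ-split {S} {c} c∈S Q = begin
      e Q S
        ≡⟨ e≡∑d⁻ Q S ⟩
      ∑[ y ∈ S ] d⁻ Q y
        ≡⟨ ∑∈-split-at {S} {c} c∈S (d⁻ Q) ⟩
      ∑[ y ∈ N⁻ S c ] d⁻ Q y + ∑[ y ∈ N⁺ S c ] d⁻ Q y + d⁻ Q c
        ≡⟨ cong₂ (λ a b → a + b + d⁻ Q c) (e≡∑d⁻ Q (N⁻ S c)) (e≡∑d⁻ Q (N⁺ S c)) ⟨
      e Q (N⁻ S c) + e Q (N⁺ S c) + d⁻ Q c                                ∎
      where open ≡-Reasoning

    ∑d²≡2∑e+∑d : ∀ W (N : Fin n → VSet n) →
                 ∑[ c ∈ W ] (size (N c) * size (N c)) ≡ 2 * ∑[ c ∈ W ] e (N c) (N c) + ∑[ c ∈ W ] size (N c)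
    ∑d²≡2∑e+∑d W N = begin
      ∑[ c ∈ W ] (size (N c) * size (N c))
        ≡⟨ ∑∈-cong W (λ {c} _ → 2e+size≡size² (N c)) ⟨
      ∑[ c ∈ W ] (2 * e (N c) (N c) + size (N c))
        ≡⟨ ∑∈-+ W (λ c → 2 * e (N c) (N c)) (λ c → size (N c)) ⟩
      ∑[ c ∈ W ] (2 * e (N c) (N c)) + ∑[ c ∈ W ] size (N c)
        ≡⟨ cong (_+ ∑[ c ∈ W ] size (N c)) (∑∈-*ˡ W 2 (λ c → e (N c) (N c))) ⟨
      2 * ∑[ c ∈ W ] e (N c) (N c) + ∑[ c ∈ W ] size (N c) ∎
      where open ≡-Reasoning

25u≤2ℓ+23 : ∀ {ℓ u E} .{{_ : NonZero u}} → 25 * E + u ≤ u * ℓ → u * u ≤ 2 * E + u → 25 * u ≤ 2 * ℓ + 23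
25u≤2ℓ+23 {ℓ} {u} {E} few u²≤2E+u = +-cancelʳ-≤ 2 (25 * u) (2 * ℓ + 23)
  (subst (25 * u + 2 ≤_) (sym (+-assoc (2 * ℓ) 23 2)) (*-cancelˡ-≤ u (begin
    u * (25 * u + 2)          ≡⟨ solve (u ∷ []) ⟩
    25 * (u * u) + 2 * u      ≤⟨ +-monoˡ-≤ (2 * u) (*-monoʳ-≤ 25 u²≤2E+u) ⟩
    25 * (2 * E + u) + 2 * u  ≡⟨ solve (E ∷ u ∷ []) ⟩
    2 * (25 * E + u) + 25 * u ≤⟨ +-monoˡ-≤ (25 * u) (*-monoʳ-≤ 2 few) ⟩
    2 * (u * ℓ) + 25 * u      ≡⟨ solve (u ∷ ℓ ∷ []) ⟩
    u * (2 * ℓ + 25)          ∎)))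
  where open ≤-Reasoning

low-degree-arith : ∀ {ℓ u E} → 4 ≤ ℓ → 25 * E + u ≤ u * ℓ → u * u ≤ 2 * E + u → 625 * E ≤ 8 * (ℓ * ℓ)
low-degree-arith {ℓ} {zero} {E} _ few _
  rewrite n≤0⇒n≡0 (≤-trans (m≤n*m E 25) (≤-trans (m≤m+n (25 * E) 0) few)) = z≤n
low-degree-arith {ℓ} {u@(suc _)} {E} 4≤ℓ few u²≤2E+u = begin
  625 * E             ≡⟨ *-assoc 25 25 E ⟩
  25 * (25 * E)       ≤⟨ *-monoʳ-≤ 25 (m≤m+n (25 * E) u) ⟩
  25 * (25 * E + u)   ≤⟨ *-monoʳ-≤ 25 few ⟩
  25 * (u * ℓ)        ≡⟨ *-assoc 25 u ℓ ⟨
  25 * u * ℓ          ≤⟨ *-monoˡ-≤ ℓ (25u≤2ℓ+23 {ℓ} {u} {E} few u²≤2E+u) ⟩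
  (2 * ℓ + 23) * ℓ    ≤⟨ *-monoˡ-≤ ℓ (+-monoʳ-≤ (2 * ℓ) (≤-trans (n≤1+n 23) (*-monoʳ-≤ 6 4≤ℓ))) ⟩
  (2 * ℓ + 6 * ℓ) * ℓ ≡⟨ solve (ℓ ∷ []) ⟩
  8 * (ℓ * ℓ)         ∎
  where open ≤-Reasoning

5s²+50m<23ms : ∀ {m s} → 4 ≤ s → s ≤ m → 5 * (s * s) + 50 * m < 23 * (m * s)
5s²+50m<23ms {m} {s} 4≤s s≤m = begin-strict
  5 * (s * s) + 50 * m
    <⟨ +-mono-≤-< (*-monoʳ-≤ 5 (*-monoˡ-≤ s s≤m)) (*-monoˡ-< m {{m≢0}} (m≤m+n 51 21)) ⟩
  5 * (m * s) + 72 * m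
    ≡⟨ solve (m ∷ s ∷ []) ⟩
  5 * (m * s) + 18 * (m * 4)
    ≤⟨ +-monoʳ-≤ (5 * (m * s)) (*-monoʳ-≤ 18 (*-monoʳ-≤ m 4≤s)) ⟩
  5 * (m * s) + 18 * (m * s)
    ≡⟨ solve (m ∷ s ∷ []) ⟩
  23 * (m * s)              ∎
  where
  open ≤-Reasoning
  m≢0 : NonZero m
  m≢0 = >-nonZero (≤-trans (s≤s z≤n) (≤-trans 4≤s s≤m))

pivot-arith : ∀ {m s t P E} → 4 ≤ s → s ≤ m →
              4 * t + m * s + 2 * P ≡ m * (s * s) → 4 * P ≤ m * (s * s) →
              25 * t ≤ P + 24 * s * E → 625 * E ≤ 16 * (s * s) → ⊥
pivot-arith {m} {s} {t} {P} {E} 4≤s s≤m 4t+ms+2P≡ms² 4P≤ms² 25t≤P+24sE 625E≤16s² =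
  <⇒≱ (5s²+50m<23ms 4≤s s≤m) (≤-trans 23ms≤192E+50m (+-monoˡ-≤ (50 * m) 192E≤5s²))
  where
  open ≤-Reasoning
  23ms²≤192sE+50ms : 23 * (m * (s * s)) ≤ 192 * s * E + 50 * (m * s)
  23ms²≤192sE+50ms = +-cancelˡ-≤ (27 * (m * (s * s))) _ _ (begin
    27 * (m * (s * s)) + 23 * (m * (s * s))
      ≡⟨ solve (m ∷ s ∷ []) ⟩
    50 * (m * (s * s))
      ≡⟨ cong (50 *_) 4t+ms+2P≡ms² ⟨
    50 * (4 * t + m * s + 2 * P)
      ≡⟨ solve (t ∷ m ∷ s ∷ P ∷ []) ⟩
    8 * (25 * t) + 50 * (m * s) + 100 * P
      ≤⟨ +-monoˡ-≤ (100 * P) (+-monoˡ-≤ (50 * (m * s)) (*-monoʳ-≤ 8 25t≤P+24sE)) ⟩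
    8 * (P + 24 * s * E) + 50 * (m * s) + 100 * P
      ≡⟨ solve (P ∷ s ∷ E ∷ m ∷ []) ⟩
    27 * (4 * P) + (192 * s * E + 50 * (m * s))
      ≤⟨ +-monoˡ-≤ (192 * s * E + 50 * (m * s)) (*-monoʳ-≤ 27 4P≤ms²) ⟩
    27 * (m * (s * s)) + (192 * s * E + 50 * (m * s)) ∎)
  23ms≤192E+50m : 23 * (m * s) ≤ 192 * E + 50 * m
  23ms≤192E+50m = *-cancelˡ-≤ s {{>-nonZero (≤-trans (s≤s z≤n) 4≤s)}} (begin
    s * (23 * (m * s))         ≡⟨ solve (s ∷ m ∷ []) ⟩
    23 * (m * (s * s))         ≤⟨ 23ms²≤192sE+50ms ⟩
    192 * s * E + 50 * (m * s) ≡⟨ solve (s ∷ E ∷ m ∷ []) ⟩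
    s * (192 * E + 50 * m)     ∎)
  192E≤5s² : 192 * E ≤ 5 * (s * s)
  192E≤5s² = *-cancelˡ-≤ 625 (begin
    625 * (192 * E)      ≡⟨ solve (E ∷ []) ⟩
    192 * (625 * E)      ≤⟨ *-monoʳ-≤ 192 625E≤16s² ⟩
    192 * (16 * (s * s)) ≡⟨ *-assoc 192 16 (s * s) ⟨
    3072 * (s * s)       ≤⟨ *-monoˡ-≤ (s * s) (m≤m+n 3072 53) ⟩
    3125 * (s * s)       ≡⟨ *-assoc 625 5 (s * s) ⟩
    625 * (5 * (s * s))  ∎)

dense-split-arith : ∀ {x y z q eS eX eY N} → x + y + 1 ≡ z → eS ≤ eX + eY + q → q ≤ N →
                    z * q ≤ 25 * (eS + N) → x * q ≤ 25 * (eX + N) ⊎ y * q ≤ 25 * (eY + N)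
dense-split-arith {x} {y} {z} {q} {eS} {eX} {eY} {N} refl eS≤ q≤N dense
  with x * q ≤? 25 * (eX + N) | y * q ≤? 25 * (eY + N)
... | yes X-dense | _           = inj₁ X-dense
... | no _        | yes Y-dense = inj₂ Y-dense
... | no X-sparse | no Y-sparse = ⊥-elim (<⇒≱ 24N<25N+2 (≤-trans 25N+2≤24q (*-monoʳ-≤ 24 q≤N)))
  where
  open ≤-Reasoning
  24N<25N+2 : 24 * N < 25 * N + 2
  24N<25N+2 = ≤-<-trans (*-monoˡ-≤ N (n≤1+n 24)) (m<m+n (25 * N) (s≤s z≤n))
  25N+2≤24q : 25 * N + 2 ≤ 24 * q
  25N+2≤24q = +-cancelˡ-≤ (25 * eX + 25 * eY + 25 * N + q) _ _ (begin
    25 * eX + 25 * eY + 25 * N + q + (25 * N + 2) ≡⟨ solve (eX ∷ eY ∷ N ∷ q ∷ []) ⟩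
    (1 + 25 * (eX + N)) + (1 + 25 * (eY + N)) + q ≤⟨ +-monoˡ-≤ q (+-mono-≤ (≰⇒> X-sparse) (≰⇒> Y-sparse)) ⟩
    x * q + y * q + q                             ≡⟨ solve (x ∷ y ∷ q ∷ []) ⟩
    (x + y + 1) * q                               ≤⟨ dense ⟩
    25 * (eS + N)                                 ≤⟨ *-monoʳ-≤ 25 (+-monoˡ-≤ N eS≤) ⟩
    25 * (eX + eY + q + N)                        ≡⟨ solve (eX ∷ eY ∷ N ∷ q ∷ []) ⟩
    25 * eX + 25 * eY + 25 * N + q + 24 * q       ∎)

4ab≤[a+b]² : ∀ a b → 4 * (a * b) ≤ (a + b) * (a + b)
4ab≤[a+b]² a b with ≤-total a b
... | inj₁ a≤b with m≤n⇒∃[o]m+o≡n a≤b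
...   | d , refl = ≤-trans (m≤m+n _ (d * d)) (≤-reflexive (solve (a ∷ d ∷ [])))
4ab≤[a+b]² a b | inj₂ b≤a with m≤n⇒∃[o]m+o≡n b≤a
...   | d , refl = ≤-trans (m≤m+n _ (d * d)) (≤-reflexive (solve (b ∷ d ∷ [])))

low : ℕ → ℕ → ℕ
low ℓ x = 𝟙 (does (25 * x <? ℓ)) * x

25f≤ab+24sx : ∀ {f} a b s x → f ≤ a * b → a * b ≤ s * x → 25 * f ≤ a * b + 24 * s * x
25f≤ab+24sx {f} a b s x f≤ab ab≤sx = begin
  25 * f               ≤⟨ *-monoʳ-≤ 25 f≤ab ⟩
  25 * (a * b)         ≡⟨ solve (a ∷ b ∷ []) ⟩
  a * b + 24 * (a * b) ≤⟨ +-monoʳ-≤ (a * b) (*-monoʳ-≤ 24 ab≤sx) ⟩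
  a * b + 24 * (s * x) ≡⟨ cong (λ z → a * b + z) (*-assoc 24 s x) ⟨
  a * b + 24 * s * x   ∎
  where open ≤-Reasoning

vertex-arith : ∀ {ℓ a b f} → f ≤ a * b → (ℓ ≤ 25 * a → ℓ ≤ 25 * b → 25 * f < a * b) →
               25 * f ≤ a * b + 24 * (a + b) * (low ℓ a + low ℓ b)
vertex-arith {ℓ} {a} {b} {f} f≤ab big⇒sparse = by-cases (25 * a <? ℓ) (25 * b <? ℓ)
  where
  open ≤-Reasoning
  by-cases : (a? : Dec (25 * a < ℓ)) (b? : Dec (25 * b < ℓ)) →
             25 * f ≤ a * b + 24 * (a + b) * (𝟙 (does a?) * a + 𝟙 (does b?) * b)
  by-cases (yes _) b? = 25f≤ab+24sx a b (a + b) (1 * a + 𝟙 (does b?) * b) f≤ab (begin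
    a * b                               ≡⟨ *-comm a b ⟩
    b * a                               ≤⟨ *-monoˡ-≤ a (m≤n+m b a) ⟩
    (a + b) * a                         ≡⟨ cong ((a + b) *_) (*-identityˡ a) ⟨
    (a + b) * (1 * a)                   ≤⟨ *-monoʳ-≤ (a + b) (m≤m+n (1 * a) _) ⟩
    (a + b) * (1 * a + 𝟙 (does b?) * b) ∎)
  by-cases (no _) (yes _) = 25f≤ab+24sx a b (a + b) (1 * b) f≤ab (begin
    a * b             ≤⟨ *-monoˡ-≤ b (m≤m+n a b) ⟩
    (a + b) * b       ≡⟨ cong ((a + b) *_) (*-identityˡ b) ⟨
    (a + b) * (1 * b) ∎)
  by-cases (no 25a≮ℓ) (no 25b≮ℓ) = ≤-trans (<⇒≤ (big⇒sparse (≮⇒≥ 25a≮ℓ) (≮⇒≥ 25b≮ℓ))) (m≤m+n _ _)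

module Pivot {n : ℕ} {T : Fin n → Fin n → Bool} (tournament : IsTournament n T) {ℓ : ℕ} (4≤ℓ : 4 ≤ ℓ) where

  open Digraph T
  open Tournament tournament

  IsPivot : VSet n → Fin n → Set
  IsPivot W c = c ∈ W × ℓ ≤ 25 * d⁻ W c × ℓ ≤ 25 * d⁺ W c × d⁻ W c * d⁺ W c ≤ 25 * e (N⁻ W c) (N⁺ W c)


  low-degree-bound : ∀ U (d : Fin n → ℕ) → e U U ≤ ∑[ c ∈ U ] d c → (∀ {c} → c ∈ U → 25 * d c < ℓ) →
                     625 * ∑[ c ∈ U ] d c ≤ 8 * (ℓ * ℓ)
  low-degree-bound U d few-arcs low-degree =
    low-degree-arith {ℓ} {size U} {∑[ c ∈ U ] d c} 4≤ℓ 25E+u≤uℓ u²≤2E+u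
    where
    open ≤-Reasoning
    25E+u≤uℓ : 25 * ∑[ c ∈ U ] d c + size U ≤ size U * ℓ
    25E+u≤uℓ = begin
      25 * ∑[ c ∈ U ] d c + size U
        ≡⟨ cong (_+ size U) (∑∈-*ˡ U 25 d) ⟩
      ∑[ c ∈ U ] (25 * d c) + size U
        ≡⟨ ∑∈-+ U (λ c → 25 * d c) (λ _ → 1) ⟨
      ∑[ c ∈ U ] (25 * d c + 1)
        ≤⟨ ∑∈-mono U (λ {c} c∈U → ≤-trans (≤-reflexive (+-comm (25 * d c) 1)) (low-degree c∈U)) ⟩
      ∑[ c ∈ U ] ℓ
        ≡⟨ ∑∈-const U ℓ ⟩
      size U * ℓ                           ∎
    u²≤2E+u : size U * size U ≤ 2 * ∑[ c ∈ U ] d c + size U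
    u²≤2E+u = begin
      size U * size U             ≡⟨ 2e+size≡size² U ⟨
      2 * e U U + size U          ≤⟨ +-monoˡ-≤ (size U) (*-monoʳ-≤ 2 few-arcs) ⟩
      2 * ∑[ c ∈ U ] d c + size U ∎

  module Counting (W : VSet n) {s : ℕ} (size≡1+s : size W ≡ suc s) where

    a b f : Fin n → ℕ
    a = d⁻ W
    b = d⁺ W
    f c = e (N⁻ W c) (N⁺ W c)

    P : ℕ
    P = ∑[ c ∈ W ] (a c * b c)

    a+b≡s : ∀ {c} → c ∈ W → a c + b c ≡ s
    a+b≡s {c} c∈W = suc-injective (begin
      suc (a c + b c) ≡⟨ +-comm (a c + b c) 1 ⟨
      a c + b c + 1   ≡⟨ size≡d⁻+d⁺+1 {W} {c} c∈W ⟨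
      size W          ≡⟨ size≡1+s ⟩
      suc s           ∎)
      where open ≡-Reasoning

    ∑[a+b]²≡ms² : ∑[ c ∈ W ] ((a c + b c) * (a c + b c)) ≡ size W * (s * s)
    ∑[a+b]²≡ms² = trans (∑∈-cong W (λ c∈W → cong (λ x → x * x) (a+b≡s c∈W))) (∑∈-const W (s * s))

    ∑[a+b]²≡∑a²+∑b²+2P : ∑[ c ∈ W ] ((a c + b c) * (a c + b c)) ≡
                         ∑[ c ∈ W ] (a c * a c) + ∑[ c ∈ W ] (b c * b c) + 2 * P
    ∑[a+b]²≡∑a²+∑b²+2P = begin
      ∑[ c ∈ W ] ((a c + b c) * (a c + b c))
        ≡⟨ ∑∈-cong W (λ {c} _ → square (a c) (b c)) ⟩
      ∑[ c ∈ W ] (a c * a c + b c * b c + 2 * (a c * b c))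
        ≡⟨ ∑∈-+ W (λ c → a c * a c + b c * b c) (λ c → 2 * (a c * b c)) ⟩
      ∑[ c ∈ W ] (a c * a c + b c * b c) + ∑[ c ∈ W ] (2 * (a c * b c))
        ≡⟨ cong₂ _+_ (sym (∑∈-+ W (λ c → a c * a c) (λ c → b c * b c))) (∑∈-*ˡ W 2 (λ c → a c * b c)) ⟨
      ∑[ c ∈ W ] (a c * a c) + ∑[ c ∈ W ] (b c * b c) + 2 * P         ∎
      where
      open ≡-Reasoning
      square : ∀ x y → (x + y) * (x + y) ≡ x * x + y * y + 2 * (x * y)
      square = solve-∀

    4t+ms+2P≡ms² : 4 * triangles W + size W * s + 2 * P ≡ size W * (s * s)
    4t+ms+2P≡ms² = begin
      4 * t + size W * s + 2 * P                ≡⟨ cong (λ z → 4 * t + z + 2 * P) ∑a+∑b≡ms ⟨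
      4 * t + (Σa + Σb) + 2 * P                 ≡⟨ regroup t Σa Σb P ⟩
      (2 * t + Σa) + (2 * t + Σb) + 2 * P       ≡⟨ cong₂ (λ x y → x + y + 2 * P) ∑a²≡2t+∑a ∑b²≡2t+∑b ⟨
      ∑[ c ∈ W ] (a c * a c) + ∑[ c ∈ W ] (b c * b c) + 2 * P
                                                ≡⟨ ∑[a+b]²≡∑a²+∑b²+2P ⟨
      ∑[ c ∈ W ] ((a c + b c) * (a c + b c))    ≡⟨ ∑[a+b]²≡ms² ⟩
      size W * (s * s)                          ∎
      where
      open ≡-Reasoning
      t Σa Σb : ℕ
      t  = triangles W
      Σa = ∑[ c ∈ W ] a c
      Σb = ∑[ c ∈ W ] b c
      regroup : ∀ t x y p → 4 * t + (x + y) + 2 * p ≡ (2 * t + x) + (2 * t + y) + 2 * p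
      regroup = solve-∀
      ∑a+∑b≡ms : Σa + Σb ≡ size W * s
      ∑a+∑b≡ms = trans (sym (∑∈-+ W a b)) (trans (∑∈-cong W a+b≡s) (∑∈-const W s))
      ∑a²≡2t+∑a : ∑[ c ∈ W ] (a c * a c) ≡ 2 * t + Σa
      ∑a²≡2t+∑a = trans (∑d²≡2∑e+∑d W (N⁻ W)) (cong (λ z → 2 * z + Σa) (∑e[N⁻,N⁻]≡triangles W))
      ∑b²≡2t+∑b : ∑[ c ∈ W ] (b c * b c) ≡ 2 * t + Σb
      ∑b²≡2t+∑b = trans (∑d²≡2∑e+∑d W (N⁺ W)) (cong (λ z → 2 * z + Σb) (∑e[N⁺,N⁺]≡triangles W))

    4P≤ms² : 4 * P ≤ size W * (s * s)
    4P≤ms² = begin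
      4 * P                                  ≡⟨ ∑∈-*ˡ W 4 (λ c → a c * b c) ⟩
      ∑[ c ∈ W ] (4 * (a c * b c))           ≤⟨ ∑∈-mono W (λ {c} _ → 4ab≤[a+b]² (a c) (b c)) ⟩
      ∑[ c ∈ W ] ((a c + b c) * (a c + b c)) ≡⟨ ∑[a+b]²≡ms² ⟩
      size W * (s * s)                       ∎
      where open ≤-Reasoning

    module _ (ℓ<size : ℓ < size W) (no-pivot : ∀ c → ¬ IsPivot W c) where

      U⁻ U⁺ : VSet n
      U⁻ = W ∩ (λ c → does (25 * a c <? ℓ))
      U⁺ = W ∩ (λ c → does (25 * b c <? ℓ))

      E⁻ E⁺ : ℕ
      E⁻ = ∑[ c ∈ U⁻ ] a c
      E⁺ = ∑[ c ∈ U⁺ ] b c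

      ℓ≤s : ℓ ≤ s
      ℓ≤s = ≤-pred (subst (ℓ <_) size≡1+s ℓ<size)

      low-sum : ∀ c → ℕ
      low-sum c = low ℓ (a c) + low ℓ (b c)

      vertex-bound : ∀ {c} → c ∈ W → 25 * f c ≤ a c * b c + 24 * s * low-sum c
      vertex-bound {c} c∈W = subst (λ x → 25 * f c ≤ a c * b c + 24 * x * low-sum c) (a+b≡s c∈W)
        (vertex-arith {ℓ} {a c} {b c} {f c} (e≤size*size (N⁻ W c) (N⁺ W c))
          (λ ℓ≤25a ℓ≤25b → ≰⇒> (λ ab≤25f → no-pivot c (c∈W , ℓ≤25a , ℓ≤25b , ab≤25f))))

      25t≤P+24sE : 25 * triangles W ≤ P + 24 * s * (E⁻ + E⁺)
      25t≤P+24sE = begin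
        25 * ∑[ c ∈ W ] f c                                  ≡⟨ ∑∈-*ˡ W 25 f ⟩
        ∑[ c ∈ W ] (25 * f c)                                ≤⟨ ∑∈-mono W vertex-bound ⟩
        ∑[ c ∈ W ] (a c * b c + 24 * s * low-sum c)          ≡⟨ ∑∈-+ W _ (λ c → 24 * s * low-sum c) ⟩
        P + ∑[ c ∈ W ] (24 * s * low-sum c)                  ≡⟨ cong (λ z → P + z) (∑∈-*ˡ W (24 * s) low-sum) ⟨
        P + 24 * s * ∑[ c ∈ W ] low-sum c                    ≡⟨ cong (λ z → P + 24 * s * z) ∑low≡E⁻+E⁺ ⟩
        P + 24 * s * (E⁻ + E⁺)                               ∎
        where
        open ≤-Reasoning
        ∑low≡E⁻+E⁺ : ∑[ c ∈ W ] low-sum c ≡ E⁻ + E⁺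
        ∑low≡E⁻+E⁺ = trans (∑∈-+ W (λ c → low ℓ (a c)) (λ c → low ℓ (b c)))
                           (sym (cong₂ _+_ (∑∈-∩ W _ a) (∑∈-∩ W _ b)))

      625E≤16s² : 625 * (E⁻ + E⁺) ≤ 16 * (s * s)
      625E≤16s² = begin
        625 * (E⁻ + E⁺)           ≡⟨ *-distribˡ-+ 625 E⁻ E⁺ ⟩
        625 * E⁻ + 625 * E⁺       ≤⟨ +-mono-≤ (low-degree-bound U⁻ a (arcs-within≤∑d⁻ U⁻⊆W) (low-sound a))
                                              (low-degree-bound U⁺ b (arcs-within≤∑d⁺ U⁺⊆W) (low-sound b)) ⟩
        8 * (ℓ * ℓ) + 8 * (ℓ * ℓ) ≤⟨ +-mono-≤ 8ℓ²≤8s² 8ℓ²≤8s² ⟩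
        8 * (s * s) + 8 * (s * s) ≡⟨ solve (s ∷ []) ⟩
        16 * (s * s)              ∎
        where
        open ≤-Reasoning
        8ℓ²≤8s² : 8 * (ℓ * ℓ) ≤ 8 * (s * s)
        8ℓ²≤8s² = *-monoʳ-≤ 8 (*-mono-≤ ℓ≤s ℓ≤s)
        U⁻⊆W : U⁻ ⊆ W
        U⁻⊆W {c} = Bool.∧-conicalˡ (W c) _
        U⁺⊆W : U⁺ ⊆ W
        U⁺⊆W {c} = Bool.∧-conicalˡ (W c) _
        low-sound : ∀ (d : Fin n → ℕ) {c} → c ∈ W ∩ (λ c → does (25 * d c <? ℓ)) → 25 * d c < ℓ
        low-sound d {c} c∈U = does≡true⇒ (25 * d c <? ℓ) (Bool.∧-conicalʳ (W c) _ c∈U)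

      no-pivot⇒⊥ : ⊥
      no-pivot⇒⊥ = pivot-arith {size W} {s} {triangles W} {P} {E⁻ + E⁺} 4≤s s≤size
                     4t+ms+2P≡ms² 4P≤ms² 25t≤P+24sE 625E≤16s²
        where
        4≤s : 4 ≤ s
        4≤s = ≤-trans 4≤ℓ ℓ≤s
        s≤size : s ≤ size W
        s≤size = ≤-trans (n≤1+n s) (≤-reflexive (sym size≡1+s))

  isPivot? : ∀ W c → Dec (IsPivot W c)
  isPivot? W c = W c Bool.≟ true ×-dec ℓ ≤? 25 * d⁻ W c ×-dec ℓ ≤? 25 * d⁺ W c
                   ×-dec d⁻ W c * d⁺ W c ≤? 25 * e (N⁻ W c) (N⁺ W c)

  pivot-exists : ∀ W → ℓ < size W → ∃ (IsPivot W)
  pivot-exists W ℓ<size with Finₚ.any? (isPivot? W)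
  ... | yes found = found
  ... | no none   = ⊥-elim (Counting.no-pivot⇒⊥ W size≡1+pred ℓ<size (λ c p → none (c , p)))
    where
    size≡1+pred : size W ≡ suc (pred (size W))
    size≡1+pred = sym (suc-pred (size W) {{>-nonZero (≤-trans (s≤s z≤n) ℓ<size)}})

splice : ∀ {A : Set} → ℕ → (ℕ → A) → (ℕ → A) → ℕ → A
splice k f g i with i <? k
... | yes _ = f i
... | no  _ = g (i ∸ k)

splice-< : ∀ {A : Set} {k i} (f g : ℕ → A) → i < k → splice k f g i ≡ f i
splice-< {k = k} {i} f g i<k with i <? k
... | yes _   = refl
... | no i≮k = ⊥-elim (i≮k i<k)

splice-+ : ∀ {A : Set} k j (f g : ℕ → A) → splice k f g (k + j) ≡ g j
splice-+ k j f g with k + j <? k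
... | yes k+j<k = ⊥-elim (<⇒≱ k+j<k (m≤m+n k j))
... | no  _     = cong g (m+n∸m≡n k j)

_◂_ : ∀ {A : Set} → A → (ℕ → A) → ℕ → A
(x ◂ f) zero    = x
(x ◂ f) (suc i) = f i

module Construction {n : ℕ} {T : Fin n → Fin n → Bool} (tournament : IsTournament n T)
                    {ℓ : ℕ} (4≤ℓ : 4 ≤ ℓ) (v₀ : Fin n) where

  open Digraph T
  open Tournament tournament
  open Pivot tournament 4≤ℓ

  record Dense (A B : VSet n) : Set where
    constructor mkDense
    field
      bound : size A * size B ≤ 25 * (e A B + n)

  dense-splitˡ : ∀ {S c} Q → c ∈ S → Dense S Q → Dense (N⁻ S c) Q ⊎ Dense (N⁺ S c) Q
  dense-splitˡ {S} {c} Q c∈S (mkDense dense) with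
    dense-split-arith {size (N⁻ S c)} {size (N⁺ S c)} {size S} {size Q} {e S Q} {e (N⁻ S c) Q} {e (N⁺ S c) Q}
      (sym (size≡d⁻+d⁺+1 {S} {c} c∈S))
      (≤-trans (≤-reflexive (eˡ-split {S} {c} c∈S Q)) (+-monoʳ-≤ _ (d⁺≤size Q c))) (size≤n Q) dense
  ... | inj₁ X-dense = inj₁ (mkDense X-dense)
  ... | inj₂ Y-dense = inj₂ (mkDense Y-dense)

  dense-splitʳ : ∀ {S c} Q → c ∈ S → Dense Q S → Dense Q (N⁻ S c) ⊎ Dense Q (N⁺ S c)
  dense-splitʳ {S} {c} Q c∈S (mkDense dense) with
    dense-split-arith {size (N⁻ S c)} {size (N⁺ S c)} {size S} {size Q} {e Q S} {e Q (N⁻ S c)} {e Q (N⁺ S c)}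
      (sym (size≡d⁻+d⁺+1 {S} {c} c∈S))
      (≤-trans (≤-reflexive (eʳ-split {S} {c} c∈S Q)) (+-monoʳ-≤ _ (d⁻≤size Q c))) (size≤n Q)
      (subst (_≤ 25 * (e Q S + n)) (*-comm (size Q) (size S)) dense)
  ... | inj₁ X-dense = inj₁ (mkDense (subst (_≤ 25 * (e Q (N⁻ S c) + n)) (*-comm (size (N⁻ S c)) (size Q))
                                             X-dense))
  ... | inj₂ Y-dense = inj₂ (mkDense (subst (_≤ 25 * (e Q (N⁺ S c) + n)) (*-comm (size (N⁺ S c)) (size Q))
                                             Y-dense))

  -- An H(ℓ,1/25)-partition of S with parts `part 0 … part k` and connecting
  -- vertices `link 0 … link (k ∸ 1)`; the other values are junk (`v₀` for a
  -- single part).  `denseˡ` and `denseʳ` make joined chains robust.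
  record Chain (S : VSet n) : Set where
    field
      k              : ℕ
      part           : ℕ → VSet n
      link           : ℕ → Fin n
      part⊆          : ∀ {i} → i ≤ k → part i ⊆ S
      link∈          : ∀ {i} → i < k → link i ∈ S
      covers         : ∀ {v} → v ∈ S → (∃ λ i → i ≤ k × v ∈ part i) ⊎ (∃ λ i → i < k × link i ≡ v)
      part-disjoint  : ∀ {i j v} → i ≤ k → j ≤ k → v ∈ part i → v ∈ part j → i ≡ j
      link-injective : ∀ {i j} → i < k → j < k → link i ≡ link j → i ≡ j
      link∉part      : ∀ {i j} → i < k → j ≤ k → link i ∈ part j → ⊥
      part-size      : ∀ {i} → i ≤ k → ℓ ≤ 25 * size (part i) × size (part i) ≤ ℓ
      part→link      : ∀ {i v} → i < k → v ∈ part i → T v (link i) ≡ true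
      link→part      : ∀ {i v} → i < k → v ∈ part (suc i) → T (link i) v ≡ true
      robust         : ∀ {i} → i < k → ∃₂ λ i′ j′ → i′ ≤ i × i < j′ × j′ ≤ k × Dense (part i′) (part j′)
      denseˡ         : ∀ {Q} → Dense S Q → ∃ λ i → i ≤ k × Dense (part i) Q
      denseʳ         : ∀ {Q} → Dense Q S → ∃ λ i → i ≤ k × Dense Q (part i)

  one-part : ∀ {S} → ℓ ≤ 25 * size S → size S ≤ ℓ → Chain S
  one-part {S} big small = record
    { k              = 0
    ; part           = λ _ → S
    ; link           = λ _ → v₀
    ; part⊆          = λ _ v∈S → v∈S
    ; link∈          = λ ()
    ; covers         = λ v∈S → inj₁ (0 , z≤n , v∈S)
    ; part-disjoint  = λ i≤0 j≤0 _ _ → trans (n≤0⇒n≡0 i≤0) (sym (n≤0⇒n≡0 j≤0))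
    ; link-injective = λ ()
    ; link∉part      = λ ()
    ; part-size      = λ _ → big , small
    ; part→link      = λ ()
    ; link→part      = λ ()
    ; robust         = λ ()
    ; denseˡ         = λ dense → 0 , z≤n , dense
    ; denseʳ         = λ dense → 0 , z≤n , dense
    }

  module Append {S : VSet n} {c : Fin n} (c∈S : c ∈ S) (X→Y-dense : Dense (N⁻ S c) (N⁺ S c))
                (L : Chain (N⁻ S c)) (R : Chain (N⁺ S c)) where

    private
      module L = Chain L
      module R = Chain R

      X Y : VSet n
      X = N⁻ S c
      Y = N⁺ S c

      k₁ k₂ : ℕ
      k₁ = L.k
      k₂ = R.k

    X⊆S : X ⊆ S
    X⊆S {v} = Bool.∧-conicalˡ (S v) (T v c)

    Y⊆S : Y ⊆ S
    Y⊆S {v} = Bool.∧-conicalˡ (S v) (T c v)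

    X→c : ∀ {v} → v ∈ X → T v c ≡ true
    X→c {v} = Bool.∧-conicalʳ (S v) (T v c)

    c→Y : ∀ {v} → v ∈ Y → T c v ≡ true
    c→Y {v} = Bool.∧-conicalʳ (S v) (T c v)

    c∉X : c ∈ X → ⊥
    c∉X c∈X = arc-asym (X→c c∈X) (X→c c∈X)

    c∉Y : c ∈ Y → ⊥
    c∉Y c∈Y = arc-asym (c→Y c∈Y) (c→Y c∈Y)

    X∩Y≡∅ : ∀ {v} → v ∈ X → v ∈ Y → ⊥
    X∩Y≡∅ v∈X v∈Y = arc-asym (X→c v∈X) (c→Y v∈Y)

    K : ℕ
    K = suc (k₁ + k₂)

    part : ℕ → VSet n
    part = splice (suc k₁) L.part R.part

    link : ℕ → Fin n
    link = splice k₁ L.link (c ◂ R.link)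

    part-left : ∀ {i} → i ≤ k₁ → part i ≡ L.part i
    part-left i≤k₁ = splice-< L.part R.part (s≤s i≤k₁)

    part-right : ∀ j → part (suc k₁ + j) ≡ R.part j
    part-right j = splice-+ (suc k₁) j L.part R.part

    part-right-zero : part (suc k₁) ≡ R.part 0
    part-right-zero = trans (cong part (sym (+-identityʳ (suc k₁)))) (part-right 0)

    part-right-suc : ∀ j → part (suc (suc k₁ + j)) ≡ R.part (suc j)
    part-right-suc j = trans (cong part (sym (+-suc (suc k₁) j))) (part-right (suc j))

    link-left : ∀ {i} → i < k₁ → link i ≡ L.link i
    link-left = splice-< L.link (c ◂ R.link)

    link-middle : link k₁ ≡ c
    link-middle = trans (cong link (sym (+-identityʳ k₁))) (splice-+ k₁ 0 L.link (c ◂ R.link))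

    link-right : ∀ j → link (suc k₁ + j) ≡ R.link j
    link-right j = trans (cong link (sym (+-suc k₁ j))) (splice-+ k₁ (suc j) L.link (c ◂ R.link))

    data PartIndex : ℕ → Set where
      left  : ∀ {i} → i ≤ k₁ → PartIndex i
      right : ∀ {j} → j ≤ k₂ → PartIndex (suc k₁ + j)

    partIndex : ∀ {i} → i ≤ K → PartIndex i
    partIndex {i} i≤K with i ≤? k₁
    ... | yes i≤k₁ = left i≤k₁
    ... | no  i≰k₁ with m≤n⇒∃[o]m+o≡n (≰⇒> i≰k₁)
    ...   | j , refl = right (+-cancelˡ-≤ k₁ j k₂ (≤-pred i≤K))

    data LinkIndex : ℕ → Set where
      left   : ∀ {i} → i < k₁ → LinkIndex i
      middle : LinkIndex k₁
      right  : ∀ {j} → j < k₂ → LinkIndex (suc k₁ + j)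

    linkIndex : ∀ {i} → i < K → LinkIndex i
    linkIndex {i} i<K with <-cmp i k₁
    ... | tri< i<k₁ _ _ = left i<k₁
    ... | tri≈ _ refl _ = middle
    ... | tri> _ _ k₁<i with m≤n⇒∃[o]m+o≡n k₁<i
    ...   | j , refl = right (+-cancelˡ-< k₁ j k₂ (≤-pred i<K))

    left≤K : ∀ {i} → i ≤ k₁ → i ≤ K
    left≤K i≤k₁ = ≤-trans i≤k₁ (≤-trans (m≤m+n k₁ k₂) (n≤1+n _))

    right≤K : ∀ {j} → j ≤ k₂ → suc k₁ + j ≤ K
    right≤K j≤k₂ = s≤s (+-monoʳ-≤ k₁ j≤k₂)

    left<K : ∀ {i} → i < k₁ → i < K
    left<K i<k₁ = ≤-trans i<k₁ (left≤K ≤-refl)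

    middle<K : k₁ < K
    middle<K = s≤s (m≤m+n k₁ k₂)

    right<K : ∀ {j} → j < k₂ → suc k₁ + j < K
    right<K j<k₂ = s≤s (+-monoʳ-< k₁ j<k₂)

    part⊆ : ∀ {i} → i ≤ K → part i ⊆ S
    part⊆ i≤K with partIndex i≤K
    ... | left p        rewrite part-left p  = λ v∈ → X⊆S (L.part⊆ p v∈)
    ... | right {j} q   rewrite part-right j = λ v∈ → Y⊆S (R.part⊆ q v∈)

    link∈ : ∀ {i} → i < K → link i ∈ S
    link∈ i<K with linkIndex i<K
    ... | left p        rewrite link-left p  = X⊆S (L.link∈ p)
    ... | middle        rewrite link-middle  = c∈S
    ... | right {j} q   rewrite link-right j = Y⊆S (R.link∈ q)

    covers : ∀ {v} → v ∈ S → (∃ λ i → i ≤ K × v ∈ part i) ⊎ (∃ λ i → i < K × link i ≡ v)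
    covers {v} v∈S with arc-trichotomy c v
    ... | inj₁ c≡v = inj₂ (k₁ , middle<K , trans link-middle c≡v)
    ... | inj₂ (inj₁ c→v) with R.covers (cong₂ _∧_ v∈S c→v)
    ...   | inj₁ (j , q , v∈) = inj₁ (suc k₁ + j , right≤K q , subst (v ∈_) (sym (part-right j)) v∈)
    ...   | inj₂ (j , q , eq) = inj₂ (suc k₁ + j , right<K q , trans (link-right j) eq)
    covers {v} v∈S | inj₂ (inj₂ v→c) with L.covers (cong₂ _∧_ v∈S v→c)
    ...   | inj₁ (i , p , v∈) = inj₁ (i , left≤K p , subst (v ∈_) (sym (part-left p)) v∈)
    ...   | inj₂ (i , p , eq) = inj₂ (i , left<K p , trans (link-left p) eq)

    part-disjoint : ∀ {i j v} → i ≤ K → j ≤ K → v ∈ part i → v ∈ part j → i ≡ j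
    part-disjoint i≤K j≤K with partIndex i≤K | partIndex j≤K
    ... | left p      | left q      rewrite part-left p  | part-left q  = L.part-disjoint p q
    ... | left p      | right {j} q rewrite part-left p  | part-right j =
      λ v∈X v∈Y → ⊥-elim (X∩Y≡∅ (L.part⊆ p v∈X) (R.part⊆ q v∈Y))
    ... | right {i} p | left q      rewrite part-right i | part-left q  =
      λ v∈Y v∈X → ⊥-elim (X∩Y≡∅ (L.part⊆ q v∈X) (R.part⊆ p v∈Y))
    ... | right {i} p | right {j} q rewrite part-right i | part-right j =
      λ v∈i v∈j → cong (λ j → suc k₁ + j) (R.part-disjoint p q v∈i v∈j)

    link-injective : ∀ {i j} → i < K → j < K → link i ≡ link j → i ≡ j
    link-injective i<K j<K with linkIndex i<K | linkIndex j<K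
    ... | left p      | left q      rewrite link-left p  | link-left q  = L.link-injective p q
    ... | left p      | middle      rewrite link-left p  | link-middle  =
      λ eq → ⊥-elim (c∉X (subst (_∈ X) eq (L.link∈ p)))
    ... | left p      | right {j} q rewrite link-left p  | link-right j =
      λ eq → ⊥-elim (X∩Y≡∅ (subst (_∈ X) eq (L.link∈ p)) (R.link∈ q))
    ... | middle      | left q      rewrite link-middle  | link-left q  =
      λ eq → ⊥-elim (c∉X (subst (_∈ X) (sym eq) (L.link∈ q)))
    ... | middle      | middle      = λ _ → refl
    ... | middle      | right {j} q rewrite link-middle  | link-right j =
      λ eq → ⊥-elim (c∉Y (subst (_∈ Y) (sym eq) (R.link∈ q)))
    ... | right {i} p | left q      rewrite link-right i | link-left q  =
      λ eq → ⊥-elim (X∩Y≡∅ (subst (_∈ X) (sym eq) (L.link∈ q)) (R.link∈ p))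
    ... | right {i} p | middle      rewrite link-right i | link-middle  =
      λ eq → ⊥-elim (c∉Y (subst (_∈ Y) eq (R.link∈ p)))
    ... | right {i} p | right {j} q rewrite link-right i | link-right j =
      λ eq → cong (λ j → suc k₁ + j) (R.link-injective p q eq)

    link∉part : ∀ {i j} → i < K → j ≤ K → link i ∈ part j → ⊥
    link∉part i<K j≤K with linkIndex i<K | partIndex j≤K
    ... | left p      | left q      rewrite link-left p  | part-left q  = L.link∉part p q
    ... | left p      | right {j} q rewrite link-left p  | part-right j =
      λ m → X∩Y≡∅ (L.link∈ p) (R.part⊆ q m)
    ... | middle      | left q      rewrite link-middle  | part-left q  = λ m → c∉X (L.part⊆ q m)
    ... | middle      | right {j} q rewrite link-middle  | part-right j = λ m → c∉Y (R.part⊆ q m)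
    ... | right {i} p | left q      rewrite link-right i | part-left q  =
      λ m → X∩Y≡∅ (L.part⊆ q m) (R.link∈ p)
    ... | right {i} p | right {j} q rewrite link-right i | part-right j = R.link∉part p q

    part-size : ∀ {i} → i ≤ K → ℓ ≤ 25 * size (part i) × size (part i) ≤ ℓ
    part-size i≤K with partIndex i≤K
    ... | left p        rewrite part-left p  = L.part-size p
    ... | right {j} q   rewrite part-right j = R.part-size q

    part→link : ∀ {i v} → i < K → v ∈ part i → T v (link i) ≡ true
    part→link i<K with linkIndex i<K
    ... | left p      rewrite part-left (<⇒≤ p) | link-left p = L.part→link p
    ... | middle      rewrite part-left (≤-refl {k₁}) | link-middle = λ v∈ → X→c (L.part⊆ ≤-refl v∈)
    ... | right {j} q rewrite part-right j | link-right j = R.part→link q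

    link→part : ∀ {i v} → i < K → v ∈ part (suc i) → T (link i) v ≡ true
    link→part i<K with linkIndex i<K
    ... | left p      rewrite part-left p | link-left p = L.link→part p
    ... | middle      rewrite part-right-zero | link-middle = λ v∈ → c→Y (R.part⊆ z≤n v∈)
    ... | right {j} q rewrite part-right-suc j | link-right j = R.link→part q

    robust : ∀ {i} → i < K → ∃₂ λ i′ j′ → i′ ≤ i × i < j′ × j′ ≤ K × Dense (part i′) (part j′)
    robust i<K with linkIndex i<K
    ... | left p with L.robust p
    ...   | i′ , j′ , i′≤i , i<j′ , j′≤k₁ , dense =
      i′ , j′ , i′≤i , i<j′ , left≤K j′≤k₁ ,
      subst₂ Dense (sym (part-left (≤-trans i′≤i (<⇒≤ p)))) (sym (part-left j′≤k₁)) dense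
    robust i<K | middle with L.denseˡ X→Y-dense
    ...   | i′ , i′≤k₁ , dense with R.denseʳ dense
    ...     | j , j≤k₂ , dense′ =
      i′ , suc k₁ + j , i′≤k₁ , s≤s (m≤m+n k₁ j) , right≤K j≤k₂ ,
      subst₂ Dense (sym (part-left i′≤k₁)) (sym (part-right j)) dense′
    robust i<K | right {j} q with R.robust q
    ...   | i′ , j′ , i′≤j , j<j′ , j′≤k₂ , dense =
      suc k₁ + i′ , suc k₁ + j′ , +-monoʳ-≤ (suc k₁) i′≤j , +-monoʳ-< (suc k₁) j<j′ , right≤K j′≤k₂ ,
      subst₂ Dense (sym (part-right i′)) (sym (part-right j′)) dense

    denseˡ : ∀ {Q} → Dense S Q → ∃ λ i → i ≤ K × Dense (part i) Q
    denseˡ {Q} dense with dense-splitˡ Q c∈S dense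
    ... | inj₁ X-dense with L.denseˡ X-dense
    ...   | i , p , dense′ = i , left≤K p , subst (λ A → Dense A Q) (sym (part-left p)) dense′
    denseˡ {Q} dense | inj₂ Y-dense with R.denseˡ Y-dense
    ...   | j , q , dense′ = suc k₁ + j , right≤K q , subst (λ A → Dense A Q) (sym (part-right j)) dense′

    denseʳ : ∀ {Q} → Dense Q S → ∃ λ i → i ≤ K × Dense Q (part i)
    denseʳ {Q} dense with dense-splitʳ Q c∈S dense
    ... | inj₁ X-dense with L.denseʳ X-dense
    ...   | i , p , dense′ = i , left≤K p , subst (Dense Q) (sym (part-left p)) dense′
    denseʳ {Q} dense | inj₂ Y-dense with R.denseʳ Y-dense
    ...   | j , q , dense′ = suc k₁ + j , right≤K q , subst (Dense Q) (sym (part-right j)) dense′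

    chain : Chain S
    chain = record
      { k = K ; part = part ; link = link ; part⊆ = part⊆ ; link∈ = link∈ ; covers = covers
      ; part-disjoint = part-disjoint ; link-injective = link-injective ; link∉part = link∉part
      ; part-size = part-size ; part→link = part→link ; link→part = link→part
      ; robust = robust ; denseˡ = denseˡ ; denseʳ = denseʳ
      }

  build : ∀ S → Acc _<_ (size S) → ℓ ≤ 25 * size S → Chain S
  build S (acc smaller) ℓ≤25∣S∣ with size S ≤? ℓ
  ... | yes small = one-part ℓ≤25∣S∣ small
  ... | no  big with pivot-exists S (≰⇒> big)
  ...   | c , c∈S , ℓ≤25d⁻ , ℓ≤25d⁺ , d⁻d⁺≤25e =
    Append.chain c∈S (mkDense (≤-trans d⁻d⁺≤25e (*-monoʳ-≤ 25 (m≤m+n (e (N⁻ S c) (N⁺ S c)) n))))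
      (build (N⁻ S c) (smaller d⁻<size) ℓ≤25d⁻)
      (build (N⁺ S c) (smaller d⁺<size) ℓ≤25d⁺)
    where
    size≡ : suc (d⁻ S c + d⁺ S c) ≡ size S
    size≡ = trans (+-comm 1 (d⁻ S c + d⁺ S c)) (sym (size≡d⁻+d⁺+1 {S} {c} c∈S))
    d⁻<size : d⁻ S c < size S
    d⁻<size = ≤-trans (s≤s (m≤m+n (d⁻ S c) (d⁺ S c))) (≤-reflexive size≡)
    d⁺<size : d⁺ S c < size S
    d⁺<size = ≤-trans (s≤s (m≤n+m (d⁺ S c) (d⁻ S c))) (≤-reflexive size≡)

  size-full : ∀ {m} → size {m} (λ _ → true) ≡ m
  size-full {zero}  = refl
  size-full {suc m} = cong suc (size-full {m})

  full-chain : ℓ ≤ n → Chain (λ _ → true)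
  full-chain ℓ≤n =
    build (λ _ → true) (<-wellFounded _)
          (subst (λ m → ℓ ≤ 25 * m) (sym (size-full {n})) (≤-trans ℓ≤n (m≤n*m n 25)))

toℚᵘ-ℕ→ℚ : ∀ m → toℚᵘ (ℕ→ℚ m) ≡ ℚᵘ.mkℚᵘ (+ m) 0
toℚᵘ-ℕ→ℚ m = cong toℚᵘ (ℚₚ.normalize-coprime {m} {0} (coprime-sym (1-coprimeTo m)))

ℕ→ℚ-nonNeg : ∀ m → NonNegative (ℕ→ℚ m)
ℕ→ℚ-nonNeg m rewrite ℚₚ.normalize-coprime {m} {0} (coprime-sym (1-coprimeTo m)) = _

ℕ→ℚ-* : ∀ a b → ℕ→ℚ (a * b) ≡ ℕ→ℚ a ℚ.* ℕ→ℚ b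
ℕ→ℚ-* a b = ℚₚ.toℚᵘ-injective (begin
  toℚᵘ (ℕ→ℚ (a * b))                   ≡⟨ toℚᵘ-ℕ→ℚ (a * b) ⟩
  ℚᵘ.mkℚᵘ (+ (a * b)) 0                ≈⟨ ℚᵘ.*≡* (cong (ℤ._* + 1) (ℤₚ.pos-* a b)) ⟩
  ℚᵘ.mkℚᵘ (+ a) 0 ℚᵘ.* ℚᵘ.mkℚᵘ (+ b) 0 ≡⟨ cong₂ ℚᵘ._*_ (toℚᵘ-ℕ→ℚ a) (toℚᵘ-ℕ→ℚ b) ⟨
  toℚᵘ (ℕ→ℚ a) ℚᵘ.* toℚᵘ (ℕ→ℚ b)       ≈⟨ ℚₚ.toℚᵘ-homo-* (ℕ→ℚ a) (ℕ→ℚ b) ⟨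
  toℚᵘ (ℕ→ℚ a ℚ.* ℕ→ℚ b)               ∎)
  where open ℚᵘₚ.≃-Reasoning

ℕ→ℚ-+ : ∀ a b → ℕ→ℚ (a + b) ≡ ℕ→ℚ a ℚ.+ ℕ→ℚ b
ℕ→ℚ-+ a b = ℚₚ.toℚᵘ-injective (begin
  toℚᵘ (ℕ→ℚ (a + b))
    ≡⟨ toℚᵘ-ℕ→ℚ (a + b) ⟩
  ℚᵘ.mkℚᵘ (+ (a + b)) 0
    ≈⟨ ℚᵘ.*≡* (cong (ℤ._* + 1) (trans (ℤₚ.pos-+ a b) (sym (cong₂ ℤ._+_ (ℤₚ.*-identityʳ (+ a))
                                                                     (ℤₚ.*-identityʳ (+ b)))))) ⟩
  ℚᵘ.mkℚᵘ (+ a) 0 ℚᵘ.+ ℚᵘ.mkℚᵘ (+ b) 0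
    ≡⟨ cong₂ ℚᵘ._+_ (toℚᵘ-ℕ→ℚ a) (toℚᵘ-ℕ→ℚ b) ⟨
  toℚᵘ (ℕ→ℚ a) ℚᵘ.+ toℚᵘ (ℕ→ℚ b)
    ≈⟨ ℚₚ.toℚᵘ-homo-+ (ℕ→ℚ a) (ℕ→ℚ b) ⟨
  toℚᵘ (ℕ→ℚ a ℚ.+ ℕ→ℚ b)                ∎)
  where open ℚᵘₚ.≃-Reasoning

ℕ→ℚ-mono-≤ : ∀ {a b} → a ≤ b → ℕ→ℚ a ≤ℚ ℕ→ℚ b
ℕ→ℚ-mono-≤ {a} {b} a≤b = ℚₚ.toℚᵘ-cancel-≤ (subst₂ ℚᵘ._≤_ (sym (toℚᵘ-ℕ→ℚ a)) (sym (toℚᵘ-ℕ→ℚ b))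
  (ℚᵘ.*≤* (subst₂ ℤ._≤_ (sym (ℤₚ.*-identityʳ (+ a))) (sym (ℤₚ.*-identityʳ (+ b))) (+≤+ a≤b))))

γ*x≤y : ∀ {γ} → γ ≤ℚ + 1 / 25 → ∀ {x y} → x ≤ 25 * y → γ ℚ.* ℕ→ℚ x ≤ℚ ℕ→ℚ y
γ*x≤y {γ} γ≤1/25 {x} {y} x≤25y = begin
  γ ℚ.* ℕ→ℚ x                     ≤⟨ ℚₚ.*-monoʳ-≤-nonNeg (ℕ→ℚ x) {{ℕ→ℚ-nonNeg x}} γ≤1/25 ⟩
  + 1 / 25 ℚ.* ℕ→ℚ x              ≤⟨ ℚₚ.*-monoˡ-≤-nonNeg (+ 1 / 25) (ℕ→ℚ-mono-≤ x≤25y) ⟩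
  + 1 / 25 ℚ.* ℕ→ℚ (25 * y)       ≡⟨ cong (+ 1 / 25 ℚ.*_) (ℕ→ℚ-* 25 y) ⟩
  + 1 / 25 ℚ.* (ℕ→ℚ 25 ℚ.* ℕ→ℚ y) ≡⟨ ℚₚ.*-assoc (+ 1 / 25) (ℕ→ℚ 25) (ℕ→ℚ y) ⟨
  (+ 1 / 25 ℚ.* ℕ→ℚ 25) ℚ.* ℕ→ℚ y ≡⟨ ℚₚ.*-identityˡ (ℕ→ℚ y) ⟩
  ℕ→ℚ y                           ∎
  where open ℚₚ.≤-Reasoning

γ*a*b-m≤e : ∀ {γ} → γ ≤ℚ + 1 / 25 → ∀ {a b e m} → a * b ≤ 25 * (e + m) →
            γ ℚ.* ℕ→ℚ a ℚ.* ℕ→ℚ b ℚ.- ℕ→ℚ m ≤ℚ ℕ→ℚ e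
γ*a*b-m≤e {γ} γ≤1/25 {a} {b} {e} {m} ab≤25[e+m] = begin
  γ ℚ.* ℕ→ℚ a ℚ.* ℕ→ℚ b ℚ.- ℕ→ℚ m
    ≡⟨ cong (ℚ._- ℕ→ℚ m) (trans (ℚₚ.*-assoc γ (ℕ→ℚ a) (ℕ→ℚ b)) (cong (γ ℚ.*_) (sym (ℕ→ℚ-* a b)))) ⟩
  γ ℚ.* ℕ→ℚ (a * b) ℚ.- ℕ→ℚ m
    ≤⟨ ℚₚ.+-monoˡ-≤ (ℚ.- ℕ→ℚ m) (γ*x≤y γ≤1/25 {a * b} {e + m} ab≤25[e+m]) ⟩
  ℕ→ℚ (e + m) ℚ.- ℕ→ℚ m
    ≡⟨ cong (ℚ._- ℕ→ℚ m) (ℕ→ℚ-+ e m) ⟩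
  ℕ→ℚ e ℚ.+ ℕ→ℚ m ℚ.- ℕ→ℚ m
    ≡⟨ ℚₚ.+-assoc (ℕ→ℚ e) (ℕ→ℚ m) (ℚ.- ℕ→ℚ m) ⟩
  ℕ→ℚ e ℚ.+ (ℕ→ℚ m ℚ.- ℕ→ℚ m)
    ≡⟨ cong (ℕ→ℚ e ℚ.+_) (ℚₚ.+-inverseʳ (ℕ→ℚ m)) ⟩
  ℕ→ℚ e ℚ.+ 0ℚ
    ≡⟨ ℚₚ.+-identityʳ (ℕ→ℚ e) ⟩
  ℕ→ℚ e                                 ∎
  where open ℚₚ.≤-Reasoning

module FromChain {n : ℕ} {T : Fin n → Fin n → Bool} (tournament : IsTournament n T)
                 {ℓ : ℕ} (4≤ℓ : 4 ≤ ℓ) (v₀ : Fin n) {γ : ℚ} (γ≤1/25 : γ ≤ℚ + 1 / 25) where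

  open Digraph T
  open Construction tournament 4≤ℓ v₀

  dense⇒robust-pair : ∀ A B → Dense A B →
                      γ ℚ.* ℕ→ℚ ∣ tabulate A ∣ˢ ℚ.* ℕ→ℚ ∣ tabulate B ∣ˢ ℚ.- ℕ→ℚ n
                        ≤ℚ ℕ→ℚ (arcs T (tabulate A) (tabulate B))
  dense⇒robust-pair A B (mkDense dense)
    rewrite ∣tabulate∣≡size A | ∣tabulate∣≡size B | arcs≡e A B =
    γ*a*b-m≤e γ≤1/25 {size A} {size B} {e A B} {n} dense

  robust-H-partition : Chain (λ _ → true) → HasRobustHPartition n T ℓ γ
  robust-H-partition C =
    k , W , w , (disjoint , w-injective , w∉W , cover , sizes , arcs-at-w) , robust′
    where
    open Chain C
    W : Fin (suc k) → Subset n
    W i = tabulate (part (toℕ i))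
    w : Fin k → Fin n
    w i = link (toℕ i)
    toℕ≤k : (i : Fin (suc k)) → toℕ i ≤ k
    toℕ≤k = Finₚ.toℕ≤pred[n]
    part-fromℕ< : ∀ {i} (i<1+k : i < suc k) → part (toℕ (fromℕ< i<1+k)) ≡ part i
    part-fromℕ< i<1+k = cong part (Finₚ.toℕ-fromℕ< i<1+k)
    disjoint : ∀ i j → i ≢ j → Disjoint (W i) (W j)
    disjoint i j i≢j x x∈i x∈j =
      i≢j (Finₚ.toℕ-injective (part-disjoint (toℕ≤k i) (toℕ≤k j) (∈-tabulate⁻ x∈i) (∈-tabulate⁻ x∈j)))
    w-injective : ∀ i j → w i ≡ w j → i ≡ j
    w-injective i j eq = Finₚ.toℕ-injective (link-injective (Finₚ.toℕ<n i) (Finₚ.toℕ<n j) eq)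
    w∉W : ∀ i j → w i ∈ˢ W j → ⊥
    w∉W i j w∈W = link∉part (Finₚ.toℕ<n i) (toℕ≤k j) (∈-tabulate⁻ w∈W)
    cover : ∀ v → (∃ λ i → v ∈ˢ W i) ⊎ (∃ λ j → w j ≡ v)
    cover v with covers {v} refl
    ... | inj₁ (i , i≤k , v∈) =
      inj₁ (fromℕ< (s≤s i≤k) , ∈-tabulate⁺ (subst (v ∈_) (sym (part-fromℕ< (s≤s i≤k))) v∈))
    ... | inj₂ (i , i<k , eq) = inj₂ (fromℕ< i<k , trans (cong link (Finₚ.toℕ-fromℕ< i<k)) eq)
    sizes : ∀ i → (γ ℚ.* ℕ→ℚ ℓ ≤ℚ ℕ→ℚ ∣ W i ∣ˢ) × (∣ W i ∣ˢ ≤ ℓ)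
    sizes i rewrite ∣tabulate∣≡size (part (toℕ i)) with part-size (toℕ≤k i)
    ... | big , small = γ*x≤y γ≤1/25 {ℓ} {size (part (toℕ i))} big , small
    arcs-at-w : ∀ i → (∀ v → v ∈ˢ W (inject₁ i) → T v (w i) ≡ true) × (∀ v → v ∈ˢ W (suc i) → T (w i) v ≡ true)
    arcs-at-w i =
      (λ v v∈ → part→link (Finₚ.toℕ<n i) (subst (λ j → v ∈ part j) (Finₚ.toℕ-inject₁ i) (∈-tabulate⁻ v∈))) ,
      (λ v v∈ → link→part (Finₚ.toℕ<n i) (∈-tabulate⁻ v∈))
    robust′ : IsRobust n T γ k W
    robust′ i with robust (Finₚ.toℕ<n i)
    ... | i′ , j′ , i′≤i , i<j′ , j′≤k , dense =
      fromℕ< i′<1+k , fromℕ< (s≤s j′≤k) ,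
      subst (_≤ toℕ i) (sym (Finₚ.toℕ-fromℕ< i′<1+k)) i′≤i ,
      subst (toℕ i <_) (sym (Finₚ.toℕ-fromℕ< (s≤s j′≤k))) i<j′ ,
      dense⇒robust-pair _ _ (subst₂ Dense (sym (part-fromℕ< i′<1+k)) (sym (part-fromℕ< (s≤s j′≤k))) dense)
      where
      i′<1+k : i′ < suc k
      i′<1+k = s≤s (≤-trans i′≤i (<⇒≤ (Finₚ.toℕ<n i)))

lemma3p12 : (γ : ℚ) → 0ℚ <ℚ γ → γ ≤ℚ (+ 1) / 25 →
    (ℓ n : ℕ) → 4 ≤ ℓ → ℓ ≤ n →
    (T : Fin n → Fin n → Bool) → IsTournament n T →
    HasRobustHPartition n T ℓ γ
lemma3p12 γ _ γ≤1/25 ℓ n 4≤ℓ ℓ≤n T tournament =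
  FromChain.robust-H-partition tournament 4≤ℓ v₀ γ≤1/25 (Construction.full-chain tournament 4≤ℓ v₀ ℓ≤n)
  where
  v₀ : Fin n
  v₀ = fromℕ< (≤-trans (s≤s z≤n) (≤-trans 4≤ℓ ℓ≤n))
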